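{- Let $T:X\to X$ and $S:Y\to Y$ be maps each of whose iterates has only finitely many fixed points, and let $T\times S$ be the Cartesian product map $(x,y)\mapsto(Tx,Sy)$. If any two of the sequences $\mathcal O_T$, $\mathcal O_S$, $\mathcal O_{T\times S}$ are multiplicative, then so is the third.
   Context: For a map $R$, $\mathcal O_R(n)$ is the number of closed orbits of $R$ of length $n$, i.e. sets $\{x,Rx,\dots,R^{n-1}x\}$ with $R^nx=x$ of cardinality exactly $n$. A sequence $f:\mathbb N\to\mathbb Z$ is multiplicative if $f(1)=1$ and $f(mn)=f(m)f(n)$ whenever $\gcd(m,n)=1$. -}

module Defs where

open import Level using (Level; _⊔_)
open import Data.Nat using (ℕ; zero; suc; _*_; _<_; _≤_)
open import Data.Nat.Coprimality using (Coprime)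
open import Data.Fin using (Fin)
open import Data.Product using (Σ; ∃; ∃-syntax; _×_; _,_)
open import Function.Bundles using (_↔_)
open import Relation.Binary.PropositionalEquality using (_≡_)

private variable a b : Level

iter : {X : Set a} → (X → X) → ℕ → X → X
iter R zero    x = x
iter R (suc n) x = R (iter R n x)

_⊗_ : {X : Set a} {Y : Set b} → (X → X) → (Y → Y) → (X × Y → X × Y)
(T ⊗ S) (x , y) = (T x , S y)

FiniteSet : {X : Set a} → (X → Set a) → Set a
FiniteSet {X = X} P = ∃[ k ] (Fin k ↔ Σ X P)

FinitelyManyFixedPoints : {X : Set a} → (X → X) → Set a
FinitelyManyFixedPoints {X = X} R =
  ∀ n → 1 ≤ n → FiniteSet (λ (x : X) → iter R n x ≡ x)

-- x generates a closed orbit {x, Rx, ..., R^{n-1}x} of length n: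
-- R^n x = x and the listed n points are pairwise distinct (the set has cardinality exactly n)
ClosedOrbitPt : {X : Set a} → (X → X) → ℕ → X → Set a
ClosedOrbitPt R n x =
  (iter R n x ≡ x) × (∀ i j → i < n → j < n → iter R i x ≡ iter R j x → i ≡ j)

SameOrbit : {X : Set a} → (X → X) → ℕ → X → X → Set a
SameOrbit R n x y = ∃[ i ] (i < n × iter R i x ≡ y)

-- the number of closed orbits of R of length n is k:
-- there are k orbit representatives, every closed orbit of length n is one of them,
-- and distinct representatives give distinct orbits
HasOrbitCount : {X : Set a} → (X → X) → ℕ → ℕ → Set a
HasOrbitCount {X = X} R n k =
  Σ (Fin k → X) λ rep →
    (∀ i → ClosedOrbitPt R n (rep i)) ×
    (∀ x → ClosedOrbitPt R n x → ∃[ i ] SameOrbit R n (rep i) x) ×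
    (∀ i j → SameOrbit R n (rep i) (rep j) → i ≡ j)

-- O : ℕ → ℕ is the orbit-counting sequence 𝒪_R (on n ≥ 1; the value at 0 is irrelevant)
IsOrbitCount : {X : Set a} → (X → X) → (ℕ → ℕ) → Set a
IsOrbitCount R O = ∀ n → 1 ≤ n → HasOrbitCount R n (O n)

Multiplicative : (ℕ → ℕ) → Set
Multiplicative f = (f 1 ≡ 1) ×
  (∀ m n → 1 ≤ m → 1 ≤ n → Coprime m n → f (m * n) ≡ f m * f n)

module Submission where

-- For a map R whose iterates have finitely many fixed points, write F_R(n) = #Fix(R^n).
-- A point fixed by R^n lies on exactly one closed orbit, whose length d divides n, and a
-- closed orbit of length d ∣ n contributes its d points; hence the fixed-point formula
--     F_R(n) = Σ_{d∣n} d · 𝒪_R(d).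
-- Since Fix((T×S)^n) = Fix(T^n) × Fix(S^n), we get F_{T×S} = F_T · F_S.  On the arithmetic
-- side, g is multiplicative iff n ↦ Σ_{d∣n} g(d) is (the converse by strong induction on m·n),
-- and d ↦ d · O(d) is multiplicative iff O is.  So 𝒪_R is multiplicative iff F_R is, and the
-- theorem reduces to: if F_{T×S} = F_T · F_S with F_T, F_S positive, two of the three
-- sequences being multiplicative forces the third.

open import Defs
open import Level using (Level)
open import Function.Base using (_∘_)
open import Data.Nat using (ℕ; zero; suc; _+_; _*_; _∸_; _≤_; _<_; z≤n; s≤s; z<s; NonZero; >-nonZero; ≢-nonZero; ≢-nonZero⁻¹)
open import Data.Nat.Properties
open import Data.Nat.Divisibility
open import Data.Nat.DivMod using (_%_; _/_; m≡m%n+[m/n]*n; m%n<n; m/n*n≡m; m*[n/m]≡n)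
open import Data.Nat.Coprimality using (Coprime; coprime-divisor; coprime-/gcd)
open import Data.Nat.GCD using (gcd; gcd[m,n]∣m; gcd[m,n]∣n; gcd[m,n]≢0)
open import Data.Nat.Induction using (<-rec)
open import Data.Bool.Properties using (T-irrelevant)
open import Data.Fin using (Fin; toℕ; fromℕ<) renaming (_≟_ to _≟ᶠ_)
open import Data.Fin.Properties using (*↔×; +↔⊎; toℕ-fromℕ<; toℕ-injective; toℕ<n)
open import Data.Fin.Permutation using (↔⇒≡)
open import Data.Product using (Σ; ∃; ∃₂; ∃-syntax; _×_; _,_; proj₁; proj₂)
open import Data.Product.Function.NonDependent.Propositional using (_×-↔_)
open import Data.Sum using (_⊎_; inj₁; inj₂)
open import Data.Sum.Function.Propositional using (_⊎-↔_)
open import Data.Empty using (⊥; ⊥-elim)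
open import Data.Unit using (tt)
open import Function.Bundles using (_↔_; mk↔ₛ′; Inverse)
open import Function.Properties.Inverse using (↔-refl; ↔-sym; ↔-trans)
open import Relation.Nullary using (Dec; yes; no; ¬_)
open import Relation.Nullary.Decidable using (True; toWitness; fromWitness; map′)
open import Relation.Binary using (tri<; tri≈; tri>)
open import Relation.Binary.PropositionalEquality
open import Axiom.UniquenessOfIdentityProofs.WithK using (uip)

private variable
  ℓ ℓ′ : Level

sameSize : {A : Set ℓ} {B : Set ℓ′} {a b : ℕ} → Fin a ↔ A → Fin b ↔ B → A ↔ B → a ≡ b
sameSize ia ib f = ↔⇒≡ (↔-trans ia (↔-trans f (↔-sym ib)))

bijection : {A : Set ℓ} {B : Set ℓ′} (f : A → B) →
            (∀ {x y} → f x ≡ f y → x ≡ y) → (∀ y → ∃ λ x → f x ≡ y) → A ↔ B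
bijection f inj surj = mk↔ₛ′ f (proj₁ ∘ surj) (proj₂ ∘ surj) (λ x → inj (proj₂ (surj (f x))))

finite⇒decEq : {A : Set ℓ} {k : ℕ} → Fin k ↔ A → (x y : A) → Dec (x ≡ y)
finite⇒decEq iso x y = map′ from-injective (cong from) (from x ≟ᶠ from y)
  where
  open Inverse iso
  from-injective : ∀ {u v} → from u ≡ from v → u ≡ v
  from-injective {u} {v} eq =
    trans (sym (strictlyInverseˡ u)) (trans (cong to eq) (strictlyInverseˡ v))

sumTo : ℕ → (ℕ → ℕ) → ℕ
sumTo zero    f = 0
sumTo (suc n) f = sumTo n f + f n

ind : {P : Set} → Dec P → ℕ → ℕ
ind (yes _) k = k
ind (no _)  k = 0

divisorSumUpTo : ℕ → ℕ → (ℕ → ℕ) → ℕ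
divisorSumUpTo n k f = sumTo k (λ e → ind (suc e ∣? n) (f (suc e)))

divisorSum : ℕ → (ℕ → ℕ) → ℕ
divisorSum n = divisorSumUpTo n n

sumTo-cong : ∀ n {f g : ℕ → ℕ} → (∀ e → e < n → f e ≡ g e) → sumTo n f ≡ sumTo n g
sumTo-cong zero    eq = refl
sumTo-cong (suc n) eq = cong₂ _+_ (sumTo-cong n (λ e e<n → eq e (m<n⇒m<1+n e<n))) (eq n (n<1+n n))

sumTo-*ˡ : ∀ n (f : ℕ → ℕ) c → c * sumTo n f ≡ sumTo n (λ e → c * f e)
sumTo-*ˡ zero    f c = *-zeroʳ c
sumTo-*ˡ (suc n) f c = trans (*-distribˡ-+ c (sumTo n f) (f n)) (cong (_+ c * f n) (sumTo-*ˡ n f c))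

sumTo-*ʳ : ∀ n (f : ℕ → ℕ) c → sumTo n f * c ≡ sumTo n (λ e → f e * c)
sumTo-*ʳ zero    f c = refl
sumTo-*ʳ (suc n) f c = trans (*-distribʳ-+ c (sumTo n f) (f n)) (cong (_+ f n * c) (sumTo-*ʳ n f c))

term≤sumTo : ∀ n (f : ℕ → ℕ) {e} → e < n → f e ≤ sumTo n f
term≤sumTo (suc n) f e<1+n with m<1+n⇒m<n∨m≡n e<1+n
... | inj₁ e<n  = ≤-trans (term≤sumTo n f e<n) (m≤m+n _ _)
... | inj₂ refl = m≤n+m _ _

ind-yes : {P : Set} (P? : Dec P) {k : ℕ} → P → ind P? k ≡ k
ind-yes (yes _) _ = refl
ind-yes (no ¬p) p = ⊥-elim (¬p p)

ind-cong : {P : Set} (P? : Dec P) {k k′ : ℕ} → (P → k ≡ k′) → ind P? k ≡ ind P? k′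
ind-cong (yes p) eq = eq p
ind-cong (no _)  eq = refl

ind-*ˡ : {P : Set} (P? : Dec P) → ∀ c k → c * ind P? k ≡ ind P? (c * k)
ind-*ˡ (yes _) c k = refl
ind-*ˡ (no _)  c k = *-zeroʳ c

ind-*ʳ : {P : Set} (P? : Dec P) → ∀ k c → ind P? k * c ≡ ind P? (k * c)
ind-*ʳ (yes _) k c = refl
ind-*ʳ (no _)  k c = refl

divisorSumUpTo-cong : ∀ n k {f g : ℕ → ℕ} → (∀ d → 0 < d → d ≤ k → d ∣ n → f d ≡ g d) →
                      divisorSumUpTo n k f ≡ divisorSumUpTo n k g
divisorSumUpTo-cong n k eq = sumTo-cong k (λ e e<k → ind-cong (suc e ∣? n) (eq (suc e) z<s e<k))

divisorSum-cong : ∀ n {f g : ℕ → ℕ} → (∀ d → 0 < d → d ∣ n → f d ≡ g d) →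
                  divisorSum n f ≡ divisorSum n g
divisorSum-cong n eq = divisorSumUpTo-cong n n (λ d 0<d _ → eq d 0<d)

divisorSum-top : ∀ k (f : ℕ → ℕ) → divisorSum (suc k) f ≡ divisorSumUpTo (suc k) k f + f (suc k)
divisorSum-top k f = cong (divisorSumUpTo (suc k) k f +_) (ind-yes (suc k ∣? suc k) ∣-refl)

divisorSum-one : (f : ℕ → ℕ) → divisorSum 1 f ≡ f 1
divisorSum-one f = ind-yes (1 ∣? 1) ∣-refl

divisorSum-≥-one : ∀ {n} (f : ℕ → ℕ) → 0 < n → f 1 ≤ divisorSum n f
divisorSum-≥-one {n} f 0<n =
  ≤-trans (≤-reflexive (sym (ind-yes (1 ∣? n) (1∣ n)))) (term≤sumTo n _ 0<n)

divisorSum-*ˡ : ∀ n (f : ℕ → ℕ) c → c * divisorSum n f ≡ divisorSum n (λ d → c * f d)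
divisorSum-*ˡ n f c = trans (sumTo-*ˡ n _ c) (sumTo-cong n (λ e _ → ind-*ˡ (suc e ∣? n) c (f (suc e))))

divisorSum-*ʳ : ∀ n (f : ℕ → ℕ) c → divisorSum n f * c ≡ divisorSum n (λ d → f d * c)
divisorSum-*ʳ n f c = trans (sumTo-*ʳ n _ c) (sumTo-cong n (λ e _ → ind-*ʳ (suc e ∣? n) (f (suc e)) c))

divisorSum-* : ∀ m n (f g : ℕ → ℕ) →
               divisorSum m f * divisorSum n g ≡ divisorSum m (λ a → divisorSum n (λ b → f a * g b))
divisorSum-* m n f g = trans (divisorSum-*ʳ m f (divisorSum n g))
  (divisorSum-cong m (λ a _ _ → divisorSum-*ˡ n g (f a)))

-- Types whose sizes are the sums above: a dependent sum over e < n, resp. over the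
-- divisors d = suc e of n, of fibres C.
Below : ℕ → (ℕ → Set) → Set
Below n C = Σ ℕ λ e → e < n × C e

DivisorΣ : ℕ → (ℕ → Set) → Set
DivisorΣ n C = Below n (λ e → True (suc e ∣? n) × C (suc e))

Below-suc : ∀ n (C : ℕ → Set) → (Below n C ⊎ C n) ↔ Below (suc n) C
Below-suc n C = mk↔ₛ′ to from to∘from from∘to
  where
  to : Below n C ⊎ C n → Below (suc n) C
  to (inj₁ (e , e<n , c)) = e , m<n⇒m<1+n e<n , c
  to (inj₂ c)             = n , n<1+n n , c
  from : Below (suc n) C → Below n C ⊎ C n
  from (e , e<1+n , c) with m<1+n⇒m<n∨m≡n e<1+n
  ... | inj₁ e<n  = inj₁ (e , e<n , c)
  ... | inj₂ refl = inj₂ c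
  to∘from : ∀ y → to (from y) ≡ y
  to∘from (e , e<1+n , c) with m<1+n⇒m<n∨m≡n e<1+n
  ... | inj₁ _    = cong (λ l → e , l , c) (<-irrelevant _ _)
  ... | inj₂ refl = cong (λ l → n , l , c) (<-irrelevant _ _)
  from∘to : ∀ x → from (to x) ≡ x
  from∘to (inj₁ (e , e<n , c)) with m<1+n⇒m<n∨m≡n (m<n⇒m<1+n e<n)
  ... | inj₁ _    = cong (λ l → inj₁ (e , l , c)) (<-irrelevant _ _)
  ... | inj₂ refl = ⊥-elim (<-irrefl refl e<n)
  from∘to (inj₂ c) with m<1+n⇒m<n∨m≡n (n<1+n n)
  ... | inj₁ n<n  = ⊥-elim (<-irrefl refl n<n)
  ... | inj₂ refl = refl

sumTo↔ : ∀ n (k : ℕ → ℕ) {C : ℕ → Set} → (∀ e → Fin (k e) ↔ C e) → Fin (sumTo n k) ↔ Below n C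
sumTo↔ zero    k iso = mk↔ₛ′ (λ ()) (λ ()) (λ ()) (λ ())
sumTo↔ (suc n) k iso = ↔-trans +↔⊎ (↔-trans (sumTo↔ n k iso ⊎-↔ iso n) (Below-suc n _))

ind↔ : {P : Set} (P? : Dec P) (k : ℕ) → Fin (ind P? k) ↔ (True P? × Fin k)
ind↔ (yes _) k = mk↔ₛ′ (tt ,_) proj₂ (λ _ → refl) (λ _ → refl)
ind↔ (no _)  k = mk↔ₛ′ (λ ()) (λ ()) (λ ()) (λ ())

divisorSum↔ : ∀ n (f : ℕ → ℕ) {C : ℕ → Set} → (∀ d → Fin (f d) ↔ C d) →
              Fin (divisorSum n f) ↔ DivisorΣ n C
divisorSum↔ n f iso = sumTo↔ n _ (λ e → ↔-trans (ind↔ (suc e ∣? n) (f (suc e))) (↔-refl ×-↔ iso (suc e)))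

DivisorΣ-≡ : ∀ {n C e} {l l′ : e < n} {t t′ : True (suc e ∣? n)} {c c′ : C (suc e)} →
             c ≡ c′ → _≡_ {A = DivisorΣ n C} (e , l , t , c) (e , l′ , t′ , c′)
DivisorΣ-≡ {l = l} {l′} {t} {t′} refl rewrite <-irrelevant l l′ | T-irrelevant t t′ = refl

DivisorΣ-fibre : ∀ {n C e} {l l′ : e < n} {t t′ : True (suc e ∣? n)} {c c′ : C (suc e)} →
                 _≡_ {A = DivisorΣ n C} (e , l , t , c) (e , l′ , t′ , c′) → c ≡ c′
DivisorΣ-fibre refl = refl

coprime-divisors : ∀ {m n a b} → Coprime m n → a ∣ m → b ∣ n → Coprime a b
coprime-divisors cop a∣m b∣n (c∣a , c∣b) = cop (∣-trans c∣a a∣m , ∣-trans c∣b b∣n)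

coprime-divisor-split : ∀ {m n d} .{{_ : NonZero d}} → Coprime m n → d ∣ m * n →
                        ∃₂ λ a b → a ∣ m × b ∣ n × a * b ≡ d
coprime-divisor-split {m} {n} {d} cop d∣mn =
  gcd d m , d / gcd d m , gcd[m,n]∣n d m , b∣n , m*[n/m]≡n (gcd[m,n]∣m d m)
  where
  a = gcd d m
  instance
    a≢0 : NonZero a
    a≢0 = ≢-nonZero (gcd[m,n]≢0 d m (inj₁ (≢-nonZero⁻¹ d)))
  m≡Ma : m ≡ m / a * a
  m≡Ma = sym (m/n*n≡m (gcd[m,n]∣n d m))
  mn≡Mna : m * n ≡ m / a * n * a
  mn≡Mna = begin
    m * n             ≡⟨ cong (_* n) m≡Ma ⟩
    m / a * a * n     ≡⟨ *-assoc (m / a) a n ⟩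
    m / a * (a * n)   ≡⟨ cong (m / a *_) (*-comm a n) ⟩
    m / a * (n * a)   ≡⟨ *-assoc (m / a) n a ⟨
    m / a * n * a     ∎
    where open ≡-Reasoning
  b∣n : d / a ∣ n
  b∣n = coprime-divisor (coprime-/gcd d m)
          (*-cancelʳ-∣ a (subst₂ _∣_ (sym (m/n*n≡m (gcd[m,n]∣m d m))) mn≡Mna d∣mn))

coprime-split-unique : ∀ {m n a b a′ b′} .{{_ : NonZero a}} → Coprime m n →
                       a ∣ m → b ∣ n → a′ ∣ m → b′ ∣ n → a * b ≡ a′ * b′ → a ≡ a′ × b ≡ b′
coprime-split-unique {a = a} {b} {a′} {b′} cop a∣m b∣n a′∣m b′∣n ab≡a′b′ =
  a≡a′ , *-cancelˡ-≡ b b′ a (trans ab≡a′b′ (cong (_* b′) (sym a≡a′)))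
  where
  a∣a′ : a ∣ a′
  a∣a′ = coprime-divisor (coprime-divisors cop a∣m b′∣n)
           (subst (a ∣_) (trans ab≡a′b′ (*-comm a′ b′)) (m∣m*n b))
  a′∣a : a′ ∣ a
  a′∣a = coprime-divisor (coprime-divisors cop a′∣m b∣n)
           (subst (a′ ∣_) (trans (sym ab≡a′b′) (*-comm a b)) (m∣m*n b′))
  a≡a′ : a ≡ a′
  a≡a′ = ∣-antisym a∣a′ a′∣a

-- For coprime m, n:  Σ_{d∣mn} h d = Σ_{a∣m} Σ_{b∣n} h (a·b).  Counting proof: (a , b) ↦ a·b
-- is a bijection from pairs of divisors of m and n onto divisors of m·n.
divisorSum-coprime : ∀ {m n} .{{_ : NonZero m}} .{{_ : NonZero n}} → Coprime m n → ∀ h →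
                     divisorSum (m * n) h ≡ divisorSum m (λ a → divisorSum n (λ b → h (a * b)))
divisorSum-coprime {m} {n} cop h =
  sameSize (divisorSum↔ (m * n) h (λ _ → ↔-refl))
           (divisorSum↔ m _ (λ a → divisorSum↔ n (λ b → h (a * b)) (λ _ → ↔-refl)))
           (↔-sym (bijection multiply multiply-injective multiply-surjective))
  where
  Pairs = DivisorΣ m (λ a → DivisorΣ n (λ b → Fin (h (a * b))))
  Products = DivisorΣ (m * n) (λ d → Fin (h d))

  -- suc a * suc b = suc (b + a * suc b), so the product divisor has index b + a * suc b
  multiply : Pairs → Products
  multiply (a , a<m , a∣m , b , b<n , b∣n , c) =
    b + a * suc b , *-mono-≤ a<m b<n , fromWitness (*-pres-∣ (toWitness a∣m) (toWitness b∣n)) , c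

  multiply-injective : ∀ {x y} → multiply x ≡ multiply y → x ≡ y
  multiply-injective {a , _ , a∣m , b , _ , b∣n , c} {a′ , _ , a′∣m , b′ , _ , b′∣n , c′} eq
    with coprime-split-unique cop (toWitness a∣m) (toWitness b∣n) (toWitness a′∣m) (toWitness b′∣n)
                                  (cong (suc ∘ proj₁) eq)
  ... | refl , refl = DivisorΣ-≡ {C = λ a → DivisorΣ n (λ b → Fin (h (a * b)))}
                        (DivisorΣ-≡ {C = λ b → Fin (h (suc a * b))} (DivisorΣ-fibre {C = λ d → Fin (h d)} eq))

  multiply-surjective : ∀ y → ∃ λ x → multiply x ≡ y
  multiply-surjective (e , _ , d∣mn , c) with coprime-divisor-split cop (toWitness d∣mn)
  ... | suc a , suc b , a∣m , b∣n , refl =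
    (a , ∣⇒≤ a∣m , fromWitness a∣m , b , ∣⇒≤ b∣n , fromWitness b∣n , c) ,
    DivisorΣ-≡ {C = λ d → Fin (h d)} refl
  ... | suc a , zero , _ , _ , a0≡d = ⊥-elim (0≢1+n (trans (sym (*-zeroʳ a)) a0≡d))
  ... | zero , _ , _ , _ , ()

multiplicative-cong : ∀ {f g : ℕ → ℕ} → (∀ n → 1 ≤ n → f n ≡ g n) →
                      Multiplicative f → Multiplicative g
multiplicative-cong {f} {g} f≡g (f1 , f-mult) =
  trans (sym (f≡g 1 ≤-refl)) f1 ,
  λ m n 1≤m 1≤n cop → begin
    g (m * n)   ≡⟨ f≡g (m * n) (*-mono-≤ 1≤m 1≤n) ⟨
    f (m * n)   ≡⟨ f-mult m n 1≤m 1≤n cop ⟩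
    f m * f n   ≡⟨ cong₂ _*_ (f≡g m 1≤m) (f≡g n 1≤n) ⟩
    g m * g n   ∎
  where open ≡-Reasoning

id-multiplicative : Multiplicative (λ n → n)
id-multiplicative = refl , λ _ _ _ _ _ → refl

*-multiplicative : ∀ {f g : ℕ → ℕ} → Multiplicative f → Multiplicative g →
                   Multiplicative (λ n → f n * g n)
*-multiplicative {f} {g} (f1 , f-mult) (g1 , g-mult) =
  cong₂ _*_ f1 g1 ,
  λ m n 1≤m 1≤n cop → begin
    f (m * n) * g (m * n)     ≡⟨ cong₂ _*_ (f-mult m n 1≤m 1≤n cop) (g-mult m n 1≤m 1≤n cop) ⟩
    (f m * f n) * (g m * g n) ≡⟨ [m*n]*[o*p]≡[m*o]*[n*p] (f m) (f n) (g m) (g n) ⟩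
    (f m * g m) * (f n * g n) ∎
  where open ≡-Reasoning

*-multiplicative⁻¹ : ∀ {f g : ℕ → ℕ} → (∀ n → 1 ≤ n → 1 ≤ f n) → Multiplicative f →
                     Multiplicative (λ n → f n * g n) → Multiplicative g
*-multiplicative⁻¹ {f} {g} f-pos (f1 , f-mult) (fg1 , fg-mult) =
  trans (sym (*-identityˡ (g 1))) (trans (cong (_* g 1) (sym f1)) fg1) ,
  λ m n 1≤m 1≤n cop →
    *-cancelˡ-≡ (g (m * n)) (g m * g n) (f (m * n)) ⦃ >-nonZero (f-pos (m * n) (*-mono-≤ 1≤m 1≤n)) ⦄
      (begin
        f (m * n) * g (m * n)     ≡⟨ fg-mult m n 1≤m 1≤n cop ⟩
        (f m * g m) * (f n * g n) ≡⟨ [m*n]*[o*p]≡[m*o]*[n*p] (f m) (g m) (f n) (g n) ⟩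
        (f m * f n) * (g m * g n) ≡⟨ cong (_* (g m * g n)) (f-mult m n 1≤m 1≤n cop) ⟨
        f (m * n) * (g m * g n)   ∎)
  where open ≡-Reasoning

divisorSum-multiplicative : ∀ {g : ℕ → ℕ} → Multiplicative g → Multiplicative (λ n → divisorSum n g)
divisorSum-multiplicative {g} (g1 , g-mult) =
  trans (divisorSum-one g) g1 ,
  λ m n 1≤m 1≤n cop → let instance _ = >-nonZero 1≤m; _ = >-nonZero 1≤n in begin
    divisorSum (m * n) g                                  ≡⟨ divisorSum-coprime cop g ⟩
    divisorSum m (λ a → divisorSum n (λ b → g (a * b)))   ≡⟨ divisorSum-cong m (λ a 0<a a∣m →
                                                               divisorSum-cong n (λ b 0<b b∣n →
                                                                 g-mult a b 0<a 0<b (coprime-divisors cop a∣m b∣n))) ⟩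
    divisorSum m (λ a → divisorSum n (λ b → g a * g b))   ≡⟨ divisorSum-* m n g g ⟨
    divisorSum m g * divisorSum n g                       ∎
  where open ≡-Reasoning

-- If F and G agree on all pairs of divisors (a , b) of (m , n) other than (m , n) itself,
-- then equal double divisor sums force F m n ≡ G m n: the top pair is the last term.
doubleSum-top : ∀ {m n} (F G : ℕ → ℕ → ℕ) → 1 ≤ m → 1 ≤ n →
                (∀ a b → 0 < a → 0 < b → a ∣ m → b ∣ n → a * b < m * n → F a b ≡ G a b) →
                divisorSum m (λ a → divisorSum n (F a)) ≡ divisorSum m (λ a → divisorSum n (G a)) →
                F m n ≡ G m n
doubleSum-top {suc m′} {suc n′} F G _ _ off-top sums≡ =
  +-cancelˡ-≡ (inner G) _ _ (+-cancelˡ-≡ (outer G) _ _ (begin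
    outer G + (inner G + F m n) ≡⟨ cong₂ (λ u v → u + (v + F m n)) outer≡ inner≡ ⟨
    outer F + (inner F + F m n) ≡⟨ split F ⟨
    divisorSum m (λ a → divisorSum n (F a)) ≡⟨ sums≡ ⟩
    divisorSum m (λ a → divisorSum n (G a)) ≡⟨ split G ⟩
    outer G + (inner G + G m n) ∎))
  where
  open ≡-Reasoning
  m = suc m′
  n = suc n′
  -- proper divisors a < m, all divisors b
  outer : (ℕ → ℕ → ℕ) → ℕ
  outer H = divisorSumUpTo m m′ (λ a → divisorSum n (H a))
  -- a = m, proper divisors b < n
  inner : (ℕ → ℕ → ℕ) → ℕ
  inner H = divisorSumUpTo n n′ (H m)
  split : ∀ H → divisorSum m (λ a → divisorSum n (H a)) ≡ outer H + (inner H + H m n)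
  split H = trans (divisorSum-top m′ (λ a → divisorSum n (H a))) (cong (outer H +_) (divisorSum-top n′ (H m)))
  outer≡ : outer F ≡ outer G
  outer≡ = divisorSumUpTo-cong m m′ (λ a 0<a a≤m′ a∣m → divisorSum-cong n (λ b 0<b b∣n →
             let instance _ = >-nonZero 0<b in
             off-top a b 0<a 0<b a∣m b∣n (<-≤-trans (*-monoˡ-< b (s≤s a≤m′)) (*-monoʳ-≤ m (∣⇒≤ b∣n)))))
  inner≡ : inner F ≡ inner G
  inner≡ = divisorSumUpTo-cong n n′ (λ b 0<b b≤n′ b∣n → off-top m b z<s 0<b ∣-refl b∣n (*-monoʳ-< m (s≤s b≤n′)))

-- Conversely, if n ↦ Σ_{d∣n} g d is multiplicative then so is g, by strong induction on m·n:
-- the double sums for g (a·b) and g a · g b agree except at the top pair (m , n).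
divisorSum-multiplicative⁻¹ : ∀ {g : ℕ → ℕ} → Multiplicative (λ n → divisorSum n g) → Multiplicative g
divisorSum-multiplicative⁻¹ {g} (G1 , G-mult) =
  trans (sym (divisorSum-one g)) G1 , λ m n → <-rec P step (m * n) m n refl
  where
  P : ℕ → Set
  P k = ∀ m n → m * n ≡ k → 1 ≤ m → 1 ≤ n → Coprime m n → g (m * n) ≡ g m * g n
  step : ∀ k → (∀ {j} → j < k → P j) → P k
  step _ ih m n refl 1≤m 1≤n cop =
    doubleSum-top (λ a b → g (a * b)) (λ a b → g a * g b) 1≤m 1≤n
      (λ a b 0<a 0<b a∣m b∣n ab<mn → ih ab<mn a b refl 0<a 0<b (coprime-divisors cop a∣m b∣n))
      (begin
        divisorSum m (λ a → divisorSum n (λ b → g (a * b))) ≡⟨ divisorSum-coprime cop g ⟨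
        divisorSum (m * n) g                                ≡⟨ G-mult m n 1≤m 1≤n cop ⟩
        divisorSum m g * divisorSum n g                     ≡⟨ divisorSum-* m n g g ⟩
        divisorSum m (λ a → divisorSum n (λ b → g a * g b)) ∎)
    where
    open ≡-Reasoning
    instance
      _ = >-nonZero 1≤m
      _ = >-nonZero 1≤n

-- Σ_{d∣n} d · O d: by the fixed-point formula below, the number of fixed points of R^n
-- when O counts the closed orbits of R.
fixedPointCount : (ℕ → ℕ) → ℕ → ℕ
fixedPointCount O n = divisorSum n (λ d → d * O d)

fixedPointCount-multiplicative : ∀ O → Multiplicative O → Multiplicative (fixedPointCount O)
fixedPointCount-multiplicative O O-mult =
  divisorSum-multiplicative {g = λ d → d * O d} (*-multiplicative {f = λ d → d} {g = O} id-multiplicative O-mult)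

fixedPointCount-multiplicative⁻¹ : ∀ O → Multiplicative (fixedPointCount O) → Multiplicative O
fixedPointCount-multiplicative⁻¹ O F-mult =
  *-multiplicative⁻¹ {g = O} (λ _ 1≤n → 1≤n) id-multiplicative
    (divisorSum-multiplicative⁻¹ {g = λ d → d * O d} F-mult)

-- A multiplicative fixed-point count is positive: the term d = 1 equals F 1 = 1.
fixedPointCount-positive : ∀ O → Multiplicative (fixedPointCount O) →
                           ∀ n → 1 ≤ n → 1 ≤ fixedPointCount O n
fixedPointCount-positive O (F1 , _) n 1≤n =
  ≤-trans (≤-reflexive (trans (sym F1) (divisorSum-one (λ d → d * O d))))
          (divisorSum-≥-one (λ d → d * O d) 1≤n)

module _ {P : ℕ → Set ℓ} (P? : ∀ c → Dec (P c)) where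

  LeastPositive : Set ℓ
  LeastPositive = ∃ λ p → 0 < p × P p × (∀ c → 0 < c → c < p → ¬ P c)

  private
    scan : ∀ k → (∀ c → 0 < c → c ≤ k → ¬ P c) ⊎ LeastPositive
    scan zero = inj₁ (λ c 0<c c≤0 _ → <⇒≱ 0<c c≤0)
    scan (suc k) with scan k
    ... | inj₂ least = inj₂ least
    ... | inj₁ none with P? (suc k)
    ...   | yes p = inj₂ (suc k , z<s , p , λ c 0<c c<1+k → none c 0<c (≤-pred c<1+k))
    ...   | no ¬p = inj₁ none′
      where
      none′ : ∀ c → 0 < c → c ≤ suc k → ¬ P c
      none′ c 0<c c≤1+k with m≤n⇒m<n∨m≡n c≤1+k
      ... | inj₁ c<1+k = none c 0<c (≤-pred c<1+k)
      ... | inj₂ refl  = ¬p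

  leastPositive : ∀ n → 0 < n → P n → LeastPositive
  leastPositive n 0<n pn with scan n
  ... | inj₁ none  = ⊥-elim (none n 0<n ≤-refl pn)
  ... | inj₂ least = least

module Iteration {a} {X : Set a} (R : X → X) where

  Fix : ℕ → Set a
  Fix n = Σ X λ x → iter R n x ≡ x

  Fix-≡ : ∀ {n x y} {p : iter R n x ≡ x} {q : iter R n y ≡ y} →
          x ≡ y → _≡_ {A = Fix n} (x , p) (y , q)
  Fix-≡ {p = p} {q} refl = cong (_ ,_) (uip p q)

  iter-+ : ∀ i j x → iter R (i + j) x ≡ iter R i (iter R j x)
  iter-+ zero    j x = refl
  iter-+ (suc i) j x = cong R (iter-+ i j x)

  iter-cong : ∀ {i j} x → i ≡ j → iter R i x ≡ iter R j x
  iter-cong x refl = refl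

  iter-fixed : ∀ {c x} t → iter R c x ≡ x → iter R c (iter R t x) ≡ iter R t x
  iter-fixed {c} {x} t p = begin
    iter R c (iter R t x) ≡⟨ iter-+ c t x ⟨
    iter R (c + t) x      ≡⟨ iter-cong x (+-comm c t) ⟩
    iter R (t + c) x      ≡⟨ iter-+ t c x ⟩
    iter R t (iter R c x) ≡⟨ cong (iter R t) p ⟩
    iter R t x            ∎
    where open ≡-Reasoning

  iter-* : ∀ {d x} q → iter R d x ≡ x → iter R (q * d) x ≡ x
  iter-* zero    p = refl
  iter-* {d} {x} (suc q) p = trans (iter-+ d (q * d) x) (trans (cong (iter R d) (iter-* q p)) p)

  iter-∣ : ∀ {d n x} → d ∣ n → iter R d x ≡ x → iter R n x ≡ x
  iter-∣ (divides q refl) p = iter-* q p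

  iter-% : ∀ {d x} .{{_ : NonZero d}} → iter R d x ≡ x → ∀ m → iter R (m % d) x ≡ iter R m x
  iter-% {d} {x} p m = begin
    iter R (m % d) x                      ≡⟨ cong (iter R (m % d)) (iter-* (m / d) p) ⟨
    iter R (m % d) (iter R (m / d * d) x) ≡⟨ iter-+ (m % d) (m / d * d) x ⟨
    iter R (m % d + m / d * d) x          ≡⟨ iter-cong x (m≡m%n+[m/n]*n m d) ⟨
    iter R m x                            ∎
    where open ≡-Reasoning

  orbit-return : ∀ {d z} j → iter R d z ≡ z → j ≤ d → iter R (d ∸ j) (iter R j z) ≡ z
  orbit-return {d} {z} j p j≤d = trans (sym (iter-+ (d ∸ j) j z)) (trans (iter-cong z (m∸n+n≡m j≤d)) p)

  closedOrbit-minimal : ∀ {d z c} → ClosedOrbitPt R d z → 0 < c → c < d → iter R c z ≢ z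
  closedOrbit-minimal (_ , distinct) 0<c c<d p with distinct _ 0 c<d (≤-<-trans z≤n c<d) p
  ... | refl = <-irrefl refl 0<c

  -- A point on a closed orbit of length d cannot lie on a longer closed orbit: that orbit
  -- would be d-periodic.
  closedOrbits-shorter : ∀ {d d′ z z′ j j′} → ClosedOrbitPt R d z → ClosedOrbitPt R d′ z′ → 0 < d →
                         j′ < d′ → iter R j z ≡ iter R j′ z′ → d < d′ → ⊥
  closedOrbits-shorter {d} {d′} {z} {z′} {j} {j′} (pz , _) cl′@(pz′ , _) 0<d j′<d′ meet d<d′ =
    closedOrbit-minimal cl′ 0<d d<d′ (begin
      iter R d z′                                ≡⟨ cong (iter R d) z′≡ ⟨
      iter R d (iter R (d′ ∸ j′) (iter R j z))   ≡⟨ iter-fixed {c = d} (d′ ∸ j′) (iter-fixed {c = d} j pz) ⟩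
      iter R (d′ ∸ j′) (iter R j z)              ≡⟨ z′≡ ⟩
      z′                                         ∎)
    where
    open ≡-Reasoning
    z′≡ : iter R (d′ ∸ j′) (iter R j z) ≡ z′
    z′≡ = trans (cong (iter R (d′ ∸ j′)) meet) (orbit-return j′ pz′ (<⇒≤ j′<d′))

  closedOrbit-length : ∀ {d d′ z z′ j j′} → ClosedOrbitPt R d z → ClosedOrbitPt R d′ z′ →
                       j < d → j′ < d′ → iter R j z ≡ iter R j′ z′ → d ≡ d′
  closedOrbit-length {d} {d′} {j = j} {j′} cl cl′ j<d j′<d′ meet with <-cmp d d′
  ... | tri< d<d′ _ _ = ⊥-elim (closedOrbits-shorter {j = j} {j′} cl cl′ (≤-<-trans z≤n j<d) j′<d′ meet d<d′)
  ... | tri≈ _ d≡d′ _ = d≡d′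
  ... | tri> _ _ d′<d = ⊥-elim (closedOrbits-shorter {j = j′} {j} cl′ cl (≤-<-trans z≤n j′<d′) j<d (sym meet) d′<d)

  -- Two d-periodic points whose forward orbits meet lie on the same orbit: z′ = R^s z with
  -- s = (d ∸ j′) + j, and s can be reduced below d.
  periodic-meet : ∀ {d z z′ j j′} .{{_ : NonZero d}} → iter R d z ≡ z → iter R d z′ ≡ z′ →
                  j′ < d → iter R j z ≡ iter R j′ z′ → SameOrbit R d z z′
  periodic-meet {d} {z} {z′} {j} {j′} pz pz′ j′<d meet = s % d , m%n<n s d , (begin
    iter R (s % d) z              ≡⟨ iter-% pz s ⟩
    iter R s z                    ≡⟨ iter-+ (d ∸ j′) j z ⟩
    iter R (d ∸ j′) (iter R j z)  ≡⟨ cong (iter R (d ∸ j′)) meet ⟩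
    iter R (d ∸ j′) (iter R j′ z′) ≡⟨ orbit-return j′ pz′ (<⇒≤ j′<d) ⟩
    z′                            ∎)
    where
    open ≡-Reasoning
    s = (d ∸ j′) + j

  -- Every periodic point lies on a closed orbit, whose length (the least period) divides
  -- the period; this needs "R^c x = x" to be decidable.
  periodic⇒closedOrbit : ∀ {n x} → (∀ c → Dec (iter R c x ≡ x)) → 0 < n → iter R n x ≡ x →
                         ∃[ d ] (0 < d × d ∣ n × ClosedOrbitPt R d x)
  periodic⇒closedOrbit {n} {x} fixed? 0<n pn with leastPositive fixed? n 0<n pn
  ... | d , 0<d , pd , minimal = d , 0<d , d∣n , pd , distinct
    where
    instance
      _ = >-nonZero 0<d
    -- the remainder n % d is again a period, hence zero by minimality
    remainder-zero : ∀ r → r < d → iter R r x ≡ x → r ≡ 0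
    remainder-zero zero      _   _  = refl
    remainder-zero r@(suc _) r<d pr = ⊥-elim (minimal r z<s r<d pr)
    d∣n : d ∣ n
    d∣n = m%n≡0⇒n∣m n d (remainder-zero (n % d) (m%n<n n d) (trans (iter-% pd n) pn))
    -- R^i x = R^j x with i < j < d would give the shorter period (d ∸ j) + i
    no-repeat : ∀ i j → i < j → j < d → iter R i x ≢ iter R j x
    no-repeat i j i<j j<d eq = minimal ((d ∸ j) + i) (≤-trans (m<n⇒0<n∸m j<d) (m≤m+n _ i))
      (<-≤-trans (+-monoʳ-< (d ∸ j) i<j) (≤-reflexive (m∸n+n≡m (<⇒≤ j<d))))
      (begin
        iter R ((d ∸ j) + i) x       ≡⟨ iter-+ (d ∸ j) i x ⟩
        iter R (d ∸ j) (iter R i x)  ≡⟨ cong (iter R (d ∸ j)) eq ⟩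
        iter R (d ∸ j) (iter R j x)  ≡⟨ orbit-return j pd (<⇒≤ j<d) ⟩
        x                            ∎)
      where open ≡-Reasoning
    distinct : ∀ i j → i < d → j < d → iter R i x ≡ iter R j x → i ≡ j
    distinct i j i<d j<d eq with <-cmp i j
    ... | tri< i<j _ _ = ⊥-elim (no-repeat i j i<j j<d eq)
    ... | tri≈ _ i≡j _ = i≡j
    ... | tri> _ _ j<i = ⊥-elim (no-repeat j i j<i i<d (sym eq))

module _ {a} {X : Set a} (R : X → X) (O : ℕ → ℕ) (orbits : IsOrbitCount R O) where
  open Iteration R

  rep : ∀ e → Fin (O (suc e)) → X
  rep e = proj₁ (orbits (suc e) z<s)

  rep-closed : ∀ e i → ClosedOrbitPt R (suc e) (rep e i)
  rep-closed e = proj₁ (proj₂ (orbits (suc e) z<s))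

  rep-cover : ∀ e x → ClosedOrbitPt R (suc e) x → ∃[ i ] SameOrbit R (suc e) (rep e i) x
  rep-cover e = proj₁ (proj₂ (proj₂ (orbits (suc e) z<s)))

  rep-distinct : ∀ e i i′ → SameOrbit R (suc e) (rep e i) (rep e i′) → i ≡ i′
  rep-distinct e = proj₂ (proj₂ (proj₂ (orbits (suc e) z<s)))

  -- Counting proof: (d , j , i) ↦ R^j (rep_d i), for d ∣ n, j < d and i < O d, is a
  -- bijection onto Fix(R^n).  Finiteness of Fix(R^n) is what makes periods decidable.
  fixedPointFormula : ∀ {n k} → 1 ≤ n → Fin k ↔ Fix n → k ≡ fixedPointCount O n
  fixedPointFormula {n} {k} 1≤n iso =
    sym (sameSize (divisorSum↔ n (λ d → d * O d) (λ d → *↔× {d} {O d})) iso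
                  (bijection point point-injective point-surjective))
    where
    instance
      _ = >-nonZero 1≤n

    point : DivisorΣ n (λ d → Fin d × Fin (O d)) → Fix n
    point (e , _ , d∣n , j , i) =
      iter R (toℕ j) (rep e i) ,
      iter-fixed {c = n} (toℕ j) (iter-∣ {d = suc e} (toWitness d∣n) (proj₁ (rep-closed e i)))

    point-injective : ∀ {u v} → point u ≡ point v → u ≡ v
    point-injective {e , _ , _ , j , i} {e′ , _ , _ , j′ , i′} eq
      with closedOrbit-length {j = toℕ j} {toℕ j′} (rep-closed e i) (rep-closed e′ i′) (toℕ<n j) (toℕ<n j′) (cong proj₁ eq)
    ... | refl with rep-distinct e i i′ (periodic-meet {j = toℕ j} {toℕ j′} (proj₁ (rep-closed e i)) (proj₁ (rep-closed e i′))
                                                       (toℕ<n j′) (cong proj₁ eq))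
    ...   | refl with toℕ-injective (proj₂ (rep-closed e i) (toℕ j) (toℕ j′) (toℕ<n j) (toℕ<n j′) (cong proj₁ eq))
    ...     | refl = DivisorΣ-≡ {C = λ d → Fin d × Fin (O d)} refl

    -- "R^c x = x" is decided by comparing R^c x and x inside the finite set Fix(R^n)
    period? : ∀ {x} → iter R n x ≡ x → ∀ c → Dec (iter R c x ≡ x)
    period? {x} px c = map′ (cong proj₁) (Fix-≡ {n = n}) (finite⇒decEq iso (iter R c x , iter-fixed {c = n} c px) (x , px))

    point-surjective : ∀ y → ∃ λ u → point u ≡ y
    point-surjective (x , px) with periodic⇒closedOrbit (period? px) 1≤n px
    ... | suc e , _ , d∣n , closed with rep-cover e x closed
    ...   | i , j , j<d , Rʲrep≡x =
      (e , ∣⇒≤ d∣n , fromWitness d∣n , fromℕ< j<d , i) ,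
      Fix-≡ {n = n} (trans (iter-cong _ (toℕ-fromℕ< j<d)) Rʲrep≡x)

module _ {a b} {X : Set a} {Y : Set b} (T : X → X) (S : Y → Y) where
  open Iteration

  iter-⊗ : ∀ n x y → iter (T ⊗ S) n (x , y) ≡ (iter T n x , iter S n y)
  iter-⊗ zero    x y = refl
  iter-⊗ (suc n) x y = cong (T ⊗ S) (iter-⊗ n x y)

  Fix-⊗ : ∀ n → (Fix T n × Fix S n) ↔ Fix (T ⊗ S) n
  Fix-⊗ n = mk↔ₛ′ to from (λ _ → Fix-≡ (T ⊗ S) {n} refl)
                           (λ _ → cong₂ _,_ (Fix-≡ T {n} refl) (Fix-≡ S {n} refl))
    where
    to : Fix T n × Fix S n → Fix (T ⊗ S) n
    to ((x , px) , (y , py)) = (x , y) , trans (iter-⊗ n x y) (cong₂ _,_ px py)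
    from : Fix (T ⊗ S) n → Fix T n × Fix S n
    from ((x , y) , pxy) = (x , cong proj₁ fixed) , (y , cong proj₂ fixed)
      where
      fixed : (iter T n x , iter S n y) ≡ (x , y)
      fixed = trans (sym (iter-⊗ n x y)) pxy

  fixedPointCount-⊗ : FinitelyManyFixedPoints T → FinitelyManyFixedPoints S →
                      ∀ {OT OS OTS} → IsOrbitCount T OT → IsOrbitCount S OS → IsOrbitCount (T ⊗ S) OTS →
                      ∀ n → 1 ≤ n → fixedPointCount OTS n ≡ fixedPointCount OT n * fixedPointCount OS n
  fixedPointCount-⊗ finT finS {OT} {OS} {OTS} orbitsT orbitsS orbitsTS n 1≤n
    with finT n 1≤n | finS n 1≤n
  ... | kT , isoT | kS , isoS = begin
    fixedPointCount OTS n                       ≡⟨ fixedPointFormula (T ⊗ S) OTS orbitsTS 1≤n isoTS ⟨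
    kT * kS                                     ≡⟨ cong₂ _*_ (fixedPointFormula T OT orbitsT 1≤n isoT)
                                                             (fixedPointFormula S OS orbitsS 1≤n isoS) ⟩
    fixedPointCount OT n * fixedPointCount OS n ∎
    where
    open ≡-Reasoning
    isoTS : Fin (kT * kS) ↔ Fix (T ⊗ S) n
    isoTS = ↔-trans *↔× (↔-trans (isoT ×-↔ isoS) (Fix-⊗ n))

-- Pass to fixed-point counts, which are multiplicative exactly when the orbit counts are,
-- and use F_{T×S} = F_T · F_S with F_T, F_S positive once multiplicative.
lemma3p1 : {a b : Level} {X : Set a} {Y : Set b} (T : X → X) (S : Y → Y) →
           FinitelyManyFixedPoints T → FinitelyManyFixedPoints S →
           (OT OS OTS : ℕ → ℕ) →
           IsOrbitCount T OT → IsOrbitCount S OS → IsOrbitCount (T ⊗ S) OTS →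
           ((Multiplicative OT × Multiplicative OS → Multiplicative OTS) ×
            (Multiplicative OT × Multiplicative OTS → Multiplicative OS) ×
            (Multiplicative OS × Multiplicative OTS → Multiplicative OT))
lemma3p1 T S finT finS OT OS OTS orbitsT orbitsS orbitsTS =
  (λ (mT , mS) → F⁻¹ OTS (multiplicative-cong (λ n 1≤n → sym (F-⊗ n 1≤n))
                           (*-multiplicative {FT} {FS} (F OT mT) (F OS mS)))) ,
  (λ (mT , mTS) → F⁻¹ OS (*-multiplicative⁻¹ {FT} {FS} (fixedPointCount-positive OT (F OT mT)) (F OT mT)
                            (multiplicative-cong F-⊗ (F OTS mTS)))) ,
  (λ (mS , mTS) → F⁻¹ OT (*-multiplicative⁻¹ {FS} {FT} (fixedPointCount-positive OS (F OS mS)) (F OS mS)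
                            (multiplicative-cong F-⊗′ (F OTS mTS))))
  where
  F = fixedPointCount-multiplicative
  F⁻¹ = fixedPointCount-multiplicative⁻¹
  FT FS FTS : ℕ → ℕ
  FT = fixedPointCount OT
  FS = fixedPointCount OS
  FTS = fixedPointCount OTS
  F-⊗ : ∀ n → 1 ≤ n → FTS n ≡ FT n * FS n
  F-⊗ = fixedPointCount-⊗ T S finT finS orbitsT orbitsS orbitsTS
  F-⊗′ : ∀ n → 1 ≤ n → FTS n ≡ FS n * FT n
  F-⊗′ n 1≤n = trans (F-⊗ n 1≤n) (*-comm (FT n) (FS n))
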